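{- Let $k\ge3$ be an integer and let $\mathrm{Cr}_k$ denote the crown graph on $2k$ vertices, i.e., the complete bipartite graph $K_{k,k}$ with a perfect matching removed (equivalently, the complement of the Cartesian product $K_k\,\square\,K_2$). If $k=2\ell+1$, then $\mathrm{Cr}_k\cong C_{2k}(A)$ where $A=\{\pm1,\pm3,\dots,\pm(2\ell-1)\}\subseteq\mathbb Z_{2k}$. If $k$ is even, then $\mathrm{Cr}_k$ is not isomorphic to any circulant graph.
   Context: For $n\in\mathbb N$ and $A\subseteq\mathbb Z_n\setminus\{0\}$ with $A=-A$, the circulant graph $C_n(A)$ has vertex set $\mathbb Z_n$, with $u,v$ adjacent iff $u-v\in A$. The Cartesian product $K_k\,\square\,K_2$ has vertex set $V(K_k)\times\{0,1\}$ with $(u,x)\sim(v,y)$ iff either $u=v,x\neq y$ or $u\neq v,x=y$. -}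

module Defs where

open import Data.Nat using (ℕ; zero; suc; _+_; _*_; _∸_; _≤_; _<_)
open import Data.Fin using (Fin; toℕ)
open import Data.Product using (Σ; _×_; _,_; ∃)
open import Data.Sum using (_⊎_)
open import Relation.Binary.PropositionalEquality using (_≡_; _≢_)
open import Relation.Nullary using (¬_)
open import Function.Bundles using (_↔_; Inverse; _⇔_)

record Graph : Set₁ where
  field
    V   : Set
    Adj : V → V → Set
open Graph public

record _≅_ (G H : Graph) : Set where
  field
    bij      : V G ↔ V H
    adj-iff  : ∀ u v → Adj G u v ⇔ Adj H (Inverse.to bij u) (Inverse.to bij v)

-- Arithmetic in ℤ_n, with ℤ_n represented by Fin n (canonical residues 0..n-1).
-- "a ≡ u - v (mod n)": since 0 ≤ v + a < 2n, this says v + a ∈ {u, u + n}.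
_≡_-_modulo_ : ∀ {n} → Fin n → Fin n → Fin n → ℕ → Set
a ≡ u - v modulo n = (toℕ v + toℕ a ≡ toℕ u) ⊎ (toℕ v + toℕ a ≡ toℕ u + n)

IsNeg : ∀ {n} → Fin n → Fin n → Set
IsNeg {n} a b = (toℕ a + toℕ b ≡ 0) ⊎ (toℕ a + toℕ b ≡ n)

ZeroFree : ∀ {n} → (Fin n → Set) → Set
ZeroFree A = ∀ a → A a → toℕ a ≢ 0

SymmetricSet : ∀ {n} → (Fin n → Set) → Set
SymmetricSet A = ∀ a b → IsNeg a b → A a → A b

Circulant : (n : ℕ) → (Fin n → Set) → Graph
Circulant n A = record
  { V   = Fin n
  ; Adj = λ u v → Σ (Fin n) (λ a → A a × (a ≡ u - v modulo n)) }

Crown : ℕ → Graph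
Crown k = record
  { V   = Fin k × Fin 2
  ; Adj = λ { (u , x) (v , y) → (x ≢ y) × (u ≢ v) } }

OddSet : (k ℓ : ℕ) → Fin (2 * k) → Set
OddSet k ℓ a = Σ ℕ λ j → (1 ≤ j) × (j ≤ ℓ) ×
  ((toℕ a ≡ 2 * j ∸ 1) ⊎ (toℕ a + (2 * j ∸ 1) ≡ 2 * k))

{-# OPTIONS --safe #-}
-- For odd k the crown graph is the Cayley graph of ℤ_k × ℤ_2 with connection set
-- {(d , 1) : d ≠ 0}; the Chinese remainder isomorphism ℤ_2k ≅ ℤ_k × ℤ_2 (`residues`) carries
-- this set to the odd residues other than k, which are ±1, ±3, …, ±(k − 2).
--
-- Conversely, let Cr_k ≅ C_n(A). The rotations of ℤ_n are automorphisms of C_n(A). As k ≥ 3,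
-- two vertices of Cr_k lie on the same side iff they have a common neighbour, and the partner
-- of a vertex is its unique non-neighbour on the other side; so rotations preserve the side
-- relation and commute with the partner map. Hence whether a rotation by one keeps the side
-- does not depend on the vertex, so a rotation by two always keeps it, while the partner of 0
-- is its antipode n / 2 = k and lies on the other side. Therefore k is odd.
module Submission where

open import Defs
open import Data.Nat using (ℕ; zero; suc; _+_; _*_; _∸_; _≤_; _<_; NonZero; z≤n; s≤s; s≤s⁻¹)
open import Data.Nat.Properties
open import Data.Nat.DivMod
open import Data.Nat.Divisibility
open import Algebra.Properties.CommutativeSemigroup +-commutativeSemigroup using (x∙yz≈y∙xz)
open import Data.Fin using (Fin; toℕ; fromℕ<; opposite) renaming (suc to fsuc)
open import Data.Fin.Patterns using (0F; 1F; 2F)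
import Data.Fin.Properties as Fin
open import Data.Fin.Permutation using (↔⇒≡)
open import Data.Product
open import Data.Product.Function.NonDependent.Propositional using (_×-⇔_)
open import Data.Sum using (_⊎_; inj₁; inj₂; [_,_]′)
open import Data.Empty using (⊥-elim)
open import Function using (_∘_)
open import Function.Bundles
open import Function.Construct.Composition using (_⇔-∘_)
open import Function.Construct.Identity using (⇔-id)
open import Function.Construct.Symmetry using (⇔-sym)
open import Function.Properties.Inverse using (↔-trans)
open import Function.Related.TypeIsomorphisms using (¬-cong-⇔)
import Function.Related.Propositional as Related
open import Relation.Binary.Definitions using (tri<; tri≈; tri>)
open import Relation.Binary.PropositionalEquality
open import Relation.Nullary using (¬_; yes; no)

Homomorphism : (G H : Graph) → (V G → V H) → Set
Homomorphism G H f = ∀ {x y} → Adj G x y → Adj H (f x) (f y)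

CommonNeighbour : (G : Graph) → V G → V G → Set
CommonNeighbour G x y = Σ (V G) λ z → Adj G z x × Adj G z y

homomorphism-CommonNeighbour : ∀ G H {f} → Homomorphism G H f →
  ∀ {x y} → CommonNeighbour G x y → CommonNeighbour H (f x) (f y)
homomorphism-CommonNeighbour _ _ f-hom (_ , zx , zy) = _ , f-hom zx , f-hom zy

retraction-reflects : ∀ {X : Set} (R : X → X → Set) {f g : X → X} →
  (∀ {x y} → R x y → R (g x) (g y)) → (∀ x → g (f x) ≡ x) →
  ∀ {x y} → R (f x) (f y) → R x y
retraction-reflects R g-preserves gf≡id {x} {y} r = subst₂ R (gf≡id x) (gf≡id y) (g-preserves r)

module _ {G H : Graph} (φ : G ≅ H) where
  open _≅_ φ
  open Inverse bij

  ≅-to-homomorphism : Homomorphism G H to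
  ≅-to-homomorphism = Equivalence.to (adj-iff _ _)

  ≅-from-Adj⇔ : ∀ {x y} → Adj H x y ⇔ Adj G (from x) (from y)
  ≅-from-Adj⇔ {x} {y} = mk⇔
    (λ h → Equivalence.from (adj-iff _ _)
             (subst₂ (Adj H) (sym (strictlyInverseˡ x)) (sym (strictlyInverseˡ y)) h))
    (λ h → subst₂ (Adj H) (strictlyInverseˡ x) (strictlyInverseˡ y) (≅-to-homomorphism h))

  ≅-from-CommonNeighbour⇔ : ∀ {x y} →
    CommonNeighbour H x y ⇔ CommonNeighbour G (from x) (from y)
  ≅-from-CommonNeighbour⇔ {x} {y} = mk⇔
    (homomorphism-CommonNeighbour H G (Equivalence.to ≅-from-Adj⇔))
    (λ c → subst₂ (CommonNeighbour H) (strictlyInverseˡ x) (strictlyInverseˡ y)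
             (homomorphism-CommonNeighbour G H ≅-to-homomorphism c))

≢⇒≡opposite : {a b : Fin 2} → a ≢ b → a ≡ opposite b
≢⇒≡opposite {0F} {0F} a≢b = ⊥-elim (a≢b refl)
≢⇒≡opposite {0F} {1F} _ = refl
≢⇒≡opposite {1F} {0F} _ = refl
≢⇒≡opposite {1F} {1F} a≢b = ⊥-elim (a≢b refl)

opposite≢ : (a : Fin 2) → opposite a ≢ a
opposite≢ 0F ()
opposite≢ 1F ()

opposite-involutive : (a : Fin 2) → opposite (opposite a) ≡ a
opposite-involutive 0F = refl
opposite-involutive 1F = refl

≢∧≢⇒≡ : {a b c : Fin 2} → a ≢ b → c ≢ b → a ≡ c
≢∧≢⇒≡ a≢b c≢b = trans (≢⇒≡opposite a≢b) (sym (≢⇒≡opposite c≢b))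

alternating⇒≡ : {a b c : Fin 2} → (b ≡ c ⇔ a ≡ b) → c ≡ a
alternating⇒≡ {a} {b} b≡c⇔a≡b with a Fin.≟ b
... | yes a≡b = trans (sym (Equivalence.from b≡c⇔a≡b a≡b)) (sym a≡b)
... | no a≢b = ≢∧≢⇒≡ (λ c≡b → a≢b (Equivalence.to b≡c⇔a≡b (sym c≡b))) a≢b

avoid-two : ∀ {k} → 3 ≤ k → (u v : Fin k) → ∃ λ w → w ≢ u × w ≢ v
avoid-two (s≤s (s≤s (s≤s _))) 0F 0F = 1F , (λ ()) , (λ ())
avoid-two (s≤s (s≤s (s≤s _))) 0F 1F = 2F , (λ ()) , (λ ())
avoid-two (s≤s (s≤s (s≤s _))) 0F (fsuc (fsuc _)) = 1F , (λ ()) , (λ ())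
avoid-two (s≤s (s≤s (s≤s _))) 1F 0F = 2F , (λ ()) , (λ ())
avoid-two (s≤s (s≤s (s≤s _))) 1F 1F = 0F , (λ ()) , (λ ())
avoid-two (s≤s (s≤s (s≤s _))) 1F (fsuc (fsuc _)) = 0F , (λ ()) , (λ ())
avoid-two (s≤s (s≤s (s≤s _))) (fsuc (fsuc _)) 0F = 1F , (λ ()) , (λ ())
avoid-two (s≤s (s≤s (s≤s _))) (fsuc (fsuc _)) (fsuc _) = 0F , (λ ()) , (λ ())

crown-CommonNeighbour⇔ : ∀ {k} → 3 ≤ k → (p q : Fin k × Fin 2) →
  CommonNeighbour (Crown k) p q ⇔ proj₂ p ≡ proj₂ q
crown-CommonNeighbour⇔ {k} k≥3 (u , x) (v , y) = mk⇔ same-side common-neighbour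
  where
  same-side : CommonNeighbour (Crown k) (u , x) (v , y) → x ≡ y
  same-side (_ , (z≢x , _) , (z≢y , _)) = ≢∧≢⇒≡ (z≢x ∘ sym) (z≢y ∘ sym)
  common-neighbour : x ≡ y → CommonNeighbour (Crown k) (u , x) (v , y)
  common-neighbour refl with avoid-two k≥3 u v
  ... | w , w≢u , w≢v = (w , opposite x) , (opposite≢ x , w≢u) , (opposite≢ x , w≢v)

mate : ∀ {k} → Fin k × Fin 2 → Fin k × Fin 2
mate (u , x) = u , opposite x

mate-involutive : ∀ {k} (p : Fin k × Fin 2) → mate (mate p) ≡ p
mate-involutive (u , x) = cong (u ,_) (opposite-involutive x)

crown-mate⇔ : ∀ {k} (p q : Fin k × Fin 2) →
  (¬ Adj (Crown k) p q × proj₂ p ≢ proj₂ q) ⇔ q ≡ mate p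
crown-mate⇔ (u , x) (v , y) = mk⇔ is-mate mate-unmatched
  where
  is-mate : ¬ Adj (Crown _) (u , x) (v , y) × x ≢ y → (v , y) ≡ (u , opposite x)
  is-mate (¬adj , x≢y) with u Fin.≟ v
  ... | yes refl = cong (u ,_) (≢⇒≡opposite (x≢y ∘ sym))
  ... | no u≢v = ⊥-elim (¬adj (x≢y , u≢v))
  mate-unmatched : (v , y) ≡ (u , opposite x) → ¬ Adj (Crown _) (u , x) (v , y) × x ≢ y
  mate-unmatched refl = (λ (_ , u≢u) → u≢u refl) , (opposite≢ x ∘ sym)

[m%d+n]%d≡[m+n]%d : ∀ m n d .{{_ : NonZero d}} → (m % d + n) % d ≡ (m + n) % d
[m%d+n]%d≡[m+n]%d m n d = begin
  (m % d + n) % d         ≡⟨ %-distribˡ-+ (m % d) n d ⟩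
  (m % d % d + n % d) % d ≡⟨ cong (λ r → (r + n % d) % d) (m%n%n≡m%n m d) ⟩
  (m % d + n % d) % d     ≡⟨ %-distribˡ-+ m n d ⟨
  (m + n) % d             ∎
  where open ≡-Reasoning

[m+n%d]%d≡[m+n]%d : ∀ m n d .{{_ : NonZero d}} → (m + n % d) % d ≡ (m + n) % d
[m+n%d]%d≡[m+n]%d m n d = begin
  (m + n % d) % d ≡⟨ cong (_% d) (+-comm m (n % d)) ⟩
  (n % d + m) % d ≡⟨ [m%d+n]%d≡[m+n]%d n m d ⟩
  (n + m) % d     ≡⟨ cong (_% d) (+-comm n m) ⟩
  (m + n) % d     ∎
  where open ≡-Reasoning

[m+n]%d≡m%d⇔d∣n : ∀ m n d .{{_ : NonZero d}} → (m + n) % d ≡ m % d ⇔ d ∣ n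
[m+n]%d≡m%d⇔d∣n m n d = mk⇔ d∣n (%-remove-+ʳ m)
  where
  open ≡-Reasoning
  d∣n : (m + n) % d ≡ m % d → d ∣ n
  d∣n eq = ∣m+n∣m⇒∣n (subst (d ∣_) (sym q₂d+n≡q₁d) (n∣m*n q₁)) (n∣m*n q₂)
    where
    q₁ = (m + n) / d
    q₂ = m / d
    q₂d+n≡q₁d : q₂ * d + n ≡ q₁ * d
    q₂d+n≡q₁d = +-cancelˡ-≡ (m % d) _ _ (begin
      m % d + (q₂ * d + n) ≡⟨ +-assoc (m % d) _ n ⟨
      m % d + q₂ * d + n   ≡⟨ cong (_+ n) (m≡m%n+[m/n]*n m d) ⟨
      m + n                ≡⟨ m≡m%n+[m/n]*n (m + n) d ⟩
      (m + n) % d + q₁ * d ≡⟨ cong (_+ q₁ * d) eq ⟩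
      m % d + q₁ * d       ∎)

%-difference : ∀ {n d u} v a .{{_ : NonZero n}} .{{_ : NonZero d}} →
  d ∣ n → (v + a) % n ≡ u → u % d ≡ v % d ⇔ d ∣ a
%-difference {n} {d} {u} v a d∣n v+a≡u =
  subst (λ r → r ≡ v % d ⇔ d ∣ a) (sym u%d≡[v+a]%d) ([m+n]%d≡m%d⇔d∣n v a d)
  where
  u%d≡[v+a]%d : u % d ≡ (v + a) % d
  u%d≡[v+a]%d = trans (cong (_% d) (sym v+a≡u)) (m∣n⇒o%n%m≡o%m d n (v + a) d∣n)

∣-summand : ∀ {d m n s} → m + n ≡ s → d ∣ s → d ∣ m → d ∣ n
∣-summand m+n≡s d∣s = ∣m+n∣m⇒∣n (subst (_ ∣_) (sym m+n≡s) d∣s)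

∣∧<2*⇒≡0⊎≡ : ∀ {k a} → k ∣ a → a < 2 * k → a ≡ 0 ⊎ a ≡ k
∣∧<2*⇒≡0⊎≡ (divides 0 refl) _ = inj₁ refl
∣∧<2*⇒≡0⊎≡ {k} (divides 1 refl) _ = inj₂ (+-identityʳ k)
∣∧<2*⇒≡0⊎≡ {k} (divides (suc (suc q)) refl) a<2k =
  ⊥-elim (<⇒≱ a<2k (*-monoˡ-≤ k (s≤s (s≤s (z≤n {q})))))

2∤1+2*i : ∀ i → 2 ∤ suc (2 * i)
2∤1+2*i i (divides q 1+2i≡q*2) = even≢odd q i (trans (*-comm 2 q) (sym 1+2i≡q*2))

odd⇒1+2* : ∀ b → 2 ∤ b → ∃ λ i → b ≡ suc (2 * i)
odd⇒1+2* 0 2∤0 = ⊥-elim (2∤0 (2 ∣0))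
odd⇒1+2* 1 _ = 0 , refl
odd⇒1+2* (suc (suc b)) 2∤2+b with odd⇒1+2* b (2∤2+b ∘ ∣m∣n⇒∣m+n ∣-refl)
... | i , refl = suc i , sym (cong suc (*-suc 2 i))

2*[1+i]∸1≡1+2*i : ∀ i → 2 * suc i ∸ 1 ≡ suc (2 * i)
2*[1+i]∸1≡1+2*i i = cong (_∸ 1) (*-suc 2 i)

toℕ-mod : ∀ m d .{{_ : NonZero d}} → toℕ (m mod d) ≡ m % d
toℕ-mod m d = Fin.toℕ-fromℕ< _

mod≡mod⇔ : ∀ m m′ d .{{_ : NonZero d}} → m mod d ≡ m′ mod d ⇔ m % d ≡ m′ % d
mod≡mod⇔ m m′ d = mk⇔
  (λ e → trans (sym (toℕ-mod m d)) (trans (cong toℕ e) (toℕ-mod m′ d)))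
  (λ e → Fin.toℕ-injective (trans (toℕ-mod m d) (trans e (sym (toℕ-mod m′ d)))))

module _ {n : ℕ} .{{_ : NonZero n}} where

  toℕ%n : (x : Fin n) → toℕ x % n ≡ toℕ x
  toℕ%n x = m<n⇒m%n≡m (Fin.toℕ<n x)

  toℕ-mod-self : (x : Fin n) → toℕ x mod n ≡ x
  toℕ-mod-self x = Fin.toℕ-injective (trans (toℕ-mod (toℕ x) n) (toℕ%n x))

  modulo⇔% : {a u v : Fin n} → (a ≡ u - v modulo n) ⇔ ((toℕ v + toℕ a) % n ≡ toℕ u)
  modulo⇔% {a} {u} {v} = mk⇔ reduce lift
    where
    open ≡-Reasoning
    s = toℕ v + toℕ a
    reduce : a ≡ u - v modulo n → s % n ≡ toℕ u
    reduce (inj₁ s≡u) = trans (cong (_% n) s≡u) (toℕ%n u)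
    reduce (inj₂ s≡u+n) = trans (cong (_% n) s≡u+n) (trans ([m+n]%n≡m%n (toℕ u) n) (toℕ%n u))
    lift : s % n ≡ toℕ u → a ≡ u - v modulo n
    lift s%n≡u with s <? n
    ... | yes s<n = inj₁ (trans (sym (m<n⇒m%n≡m s<n)) s%n≡u)
    ... | no s≮n = inj₂ (begin
      s         ≡⟨ m∸n+n≡m n≤s ⟨
      s ∸ n + n ≡⟨ cong (_+ n) s∸n≡u ⟩
      toℕ u + n ∎)
      where
      n≤s = ≮⇒≥ s≮n
      s∸n<n : s ∸ n < n
      s∸n<n = m<n+o⇒m∸n<o s n (+-mono-< (Fin.toℕ<n v) (Fin.toℕ<n a))
      s∸n≡u : s ∸ n ≡ toℕ u
      s∸n≡u = trans (sym (m<n⇒m%n≡m s∸n<n)) (trans (m≤n⇒[n∸m]%m≡n%m n≤s) s%n≡u)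

  difference : (u v : Fin n) → ∃ λ a → a ≡ u - v modulo n
  difference u v = a , Equivalence.from (modulo⇔% {a} {u} {v}) (begin
    (toℕ v + toℕ a) % n           ≡⟨ cong (λ r → (toℕ v + r) % n) (toℕ-mod (toℕ u + w) n) ⟩
    (toℕ v + (toℕ u + w) % n) % n ≡⟨ [m+n%d]%d≡[m+n]%d (toℕ v) _ n ⟩
    (toℕ v + (toℕ u + w)) % n     ≡⟨ cong (_% n) (x∙yz≈y∙xz (toℕ v) (toℕ u) w) ⟩
    (toℕ u + (toℕ v + w)) % n     ≡⟨ cong (λ r → (toℕ u + r) % n) (m+[n∸m]≡n v≤n) ⟩
    (toℕ u + n) % n               ≡⟨ [m+n]%n≡m%n (toℕ u) n ⟩
    toℕ u % n                     ≡⟨ toℕ%n u ⟩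
    toℕ u                         ∎)
    where
    open ≡-Reasoning
    w = n ∸ toℕ v
    a = (toℕ u + w) mod n
    v≤n = <⇒≤ (Fin.toℕ<n v)

  mod-difference : ∀ {d} .{{_ : NonZero d}} {a u v : Fin n} → d ∣ n → a ≡ u - v modulo n →
    toℕ u mod d ≡ toℕ v mod d ⇔ d ∣ toℕ a
  mod-difference {d} {a} {u} {v} d∣n a≡u-v =
    %-difference (toℕ v) (toℕ a) d∣n (Equivalence.to (modulo⇔% {a} {u} {v}) a≡u-v)
    ⇔-∘ mod≡mod⇔ (toℕ u) (toℕ v) d

  zero-difference : {a u v : Fin n} → a ≡ u - v modulo n → toℕ a ≡ 0 → u ≡ v
  zero-difference {a} {u} {v} a≡u-v a≡0 = Fin.toℕ-injective (begin
    toℕ u               ≡⟨ Equivalence.to (modulo⇔% {a} {u} {v}) a≡u-v ⟨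
    (toℕ v + toℕ a) % n ≡⟨ cong (λ r → (toℕ v + r) % n) a≡0 ⟩
    (toℕ v + 0) % n     ≡⟨ cong (_% n) (+-identityʳ (toℕ v)) ⟩
    toℕ v % n           ≡⟨ toℕ%n v ⟩
    toℕ v               ∎)
    where open ≡-Reasoning

  rotate : ℕ → Fin n → Fin n
  rotate j x = (j + toℕ x) mod n

  rotate-rotate : ∀ i j x → rotate i (rotate j x) ≡ rotate (i + j) x
  rotate-rotate i j x = Fin.toℕ-injective (begin
    toℕ (rotate i (rotate j x)) ≡⟨ toℕ-mod (i + toℕ (rotate j x)) n ⟩
    (i + toℕ (rotate j x)) % n  ≡⟨ cong (λ r → (i + r) % n) (toℕ-mod (j + toℕ x) n) ⟩
    (i + (j + toℕ x) % n) % n   ≡⟨ [m+n%d]%d≡[m+n]%d i _ n ⟩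
    (i + (j + toℕ x)) % n       ≡⟨ cong (_% n) (+-assoc i j _) ⟨
    (i + j + toℕ x) % n         ≡⟨ toℕ-mod (i + j + toℕ x) n ⟨
    toℕ (rotate (i + j) x)      ∎)
    where open ≡-Reasoning

  rotate-zero : ∀ x → rotate 0 x ≡ x
  rotate-zero = toℕ-mod-self

  rotate-n : ∀ x → rotate n x ≡ x
  rotate-n x = Fin.toℕ-injective (begin
    toℕ (rotate n x) ≡⟨ toℕ-mod (n + toℕ x) n ⟩
    (n + toℕ x) % n  ≡⟨ %-remove-+ˡ (toℕ x) ∣-refl ⟩
    toℕ x % n        ≡⟨ toℕ%n x ⟩
    toℕ x            ∎)
    where open ≡-Reasoning

  rotate-retraction : ∀ {j} → j ≤ n → ∀ x → rotate (n ∸ j) (rotate j x) ≡ x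
  rotate-retraction {j} j≤n x = begin
    rotate (n ∸ j) (rotate j x) ≡⟨ rotate-rotate (n ∸ j) j x ⟩
    rotate (n ∸ j + j) x        ≡⟨ cong (λ i → rotate i x) (m∸n+n≡m j≤n) ⟩
    rotate n x                  ≡⟨ rotate-n x ⟩
    x                           ∎
    where open ≡-Reasoning

  module _ {A : Fin n → Set} where
    private
      C = Circulant n A

    rotate-homomorphism : ∀ j → Homomorphism C C (rotate j)
    rotate-homomorphism j {u} {v} (a , a∈A , a≡u-v) =
      a , a∈A , Equivalence.from (modulo⇔% {a} {rotate j u} {rotate j v}) (begin
        (toℕ (rotate j v) + toℕ a) % n ≡⟨ cong (λ r → (r + toℕ a) % n) (toℕ-mod (j + toℕ v) n) ⟩
        ((j + toℕ v) % n + toℕ a) % n  ≡⟨ [m%d+n]%d≡[m+n]%d (j + toℕ v) _ n ⟩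
        (j + toℕ v + toℕ a) % n        ≡⟨ cong (_% n) (+-assoc j _ _) ⟩
        (j + (toℕ v + toℕ a)) % n      ≡⟨ [m+n%d]%d≡[m+n]%d j _ n ⟨
        (j + (toℕ v + toℕ a) % n) % n  ≡⟨ cong (λ r → (j + r) % n) v+a≡u ⟩
        (j + toℕ u) % n                ≡⟨ toℕ-mod (j + toℕ u) n ⟨
        toℕ (rotate j u)               ∎)
      where
      open ≡-Reasoning
      v+a≡u = Equivalence.to (modulo⇔% {a} {u} {v}) a≡u-v

    rotate-Adj⇔ : ∀ {j x y} → j ≤ n → Adj C (rotate j x) (rotate j y) ⇔ Adj C x y
    rotate-Adj⇔ {j} j≤n = mk⇔
      (retraction-reflects (Adj C) (rotate-homomorphism (n ∸ j)) (rotate-retraction j≤n))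
      (rotate-homomorphism j)

    rotate-CommonNeighbour⇔ : ∀ {j x y} → j ≤ n →
      CommonNeighbour C (rotate j x) (rotate j y) ⇔ CommonNeighbour C x y
    rotate-CommonNeighbour⇔ {j} j≤n = mk⇔
      (retraction-reflects (CommonNeighbour C)
        (homomorphism-CommonNeighbour C C (rotate-homomorphism (n ∸ j))) (rotate-retraction j≤n))
      (homomorphism-CommonNeighbour C C (rotate-homomorphism j))

-- k is written suc (2 * ℓ) rather than 2 * ℓ + 1 so that k and 2 * k are visibly nonzero.
module OddCrown (ℓ : ℕ) where
  k : ℕ
  k = suc (2 * ℓ)

  2∤k : 2 ∤ k
  2∤k = 2∤1+2*i ℓ

  odd-index : ∀ {b} → 2 ∤ b → b < k → Σ ℕ λ j → 1 ≤ j × j ≤ ℓ × b ≡ 2 * j ∸ 1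
  odd-index {b} 2∤b b<k with odd⇒1+2* b 2∤b
  ... | i , refl = suc i , s≤s z≤n , *-cancelˡ-< 2 i ℓ (s≤s⁻¹ b<k) , sym (2*[1+i]∸1≡1+2*i i)

  index-odd : ∀ {j} → 1 ≤ j → j ≤ ℓ → 2 ∤ 2 * j ∸ 1 × k ∤ 2 * j ∸ 1
  index-odd {suc i} _ i<ℓ = subst (λ o → 2 ∤ o × k ∤ o) (sym (2*[1+i]∸1≡1+2*i i))
    (2∤1+2*i i , >⇒∤ (s≤s (*-monoʳ-< 2 i<ℓ)))

  oddSet⇔ : (a : Fin (2 * k)) → OddSet k ℓ a ⇔ (2 ∤ toℕ a × k ∤ toℕ a)
  oddSet⇔ a = mk⇔ odd-nonmultiple odd-set
    where
    A = toℕ a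
    odd-nonmultiple : OddSet k ℓ a → 2 ∤ A × k ∤ A
    odd-nonmultiple (j , 1≤j , j≤ℓ , inj₁ A≡o) =
      subst (λ m → 2 ∤ m × k ∤ m) (sym A≡o) (index-odd 1≤j j≤ℓ)
    odd-nonmultiple (j , 1≤j , j≤ℓ , inj₂ A+o≡2k) =
      (2∤o ∘ ∣-summand A+o≡2k (m∣m*n k)) , (k∤o ∘ ∣-summand A+o≡2k (n∣m*n 2))
      where
      2∤o = proj₁ (index-odd 1≤j j≤ℓ)
      k∤o = proj₂ (index-odd 1≤j j≤ℓ)
    odd-set : 2 ∤ A × k ∤ A → OddSet k ℓ a
    odd-set (2∤A , k∤A) with <-cmp A k
    ... | tri≈ _ A≡k _ = ⊥-elim (k∤A (subst (k ∣_) (sym A≡k) ∣-refl))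
    ... | tri< A<k _ _ = let (j , 1≤j , j≤ℓ , A≡o) = odd-index 2∤A A<k
                         in j , 1≤j , j≤ℓ , inj₁ A≡o
    ... | tri> _ _ k<A = let (j , 1≤j , j≤ℓ , B≡o) = odd-index 2∤B B<k
                         in j , 1≤j , j≤ℓ , inj₂ (trans (cong (A +_) (sym B≡o)) A+B≡2k)
      where
      B = 2 * k ∸ A
      A+B≡2k : A + B ≡ 2 * k
      A+B≡2k = m+[n∸m]≡n (<⇒≤ (Fin.toℕ<n a))
      B<k : B < k
      B<k = subst (B <_) (trans (m+n∸m≡n k (k + 0)) (+-identityʳ k))
                  (∸-monoʳ-< k<A (<⇒≤ (Fin.toℕ<n a)))
      2∤B : 2 ∤ B
      2∤B = 2∤A ∘ ∣-summand (trans (+-comm B A) A+B≡2k) (m∣m*n k)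

  residues : Fin (2 * k) → Fin k × Fin 2
  residues X = toℕ X mod k , toℕ X mod 2

  residues-injective : ∀ {X Y} → residues X ≡ residues Y → X ≡ Y
  residues-injective {X} {Y} eq =
    [ zero-difference a≡X-Y , (λ a≡k → ⊥-elim (2∤k (subst (2 ∣_) a≡k 2∣a))) ]′
      (∣∧<2*⇒≡0⊎≡ k∣a (Fin.toℕ<n a))
    where
    a = proj₁ (difference X Y)
    a≡X-Y = proj₂ (difference X Y)
    k∣a = Equivalence.to (mod-difference (n∣m*n 2) a≡X-Y) (cong proj₁ eq)
    2∣a = Equivalence.to (mod-difference (m∣m*n k) a≡X-Y) (cong proj₂ eq)

  toℕ<2k : (u : Fin k) → toℕ u < 2 * k
  toℕ<2k u = <-≤-trans (Fin.toℕ<n u) (m≤m+n k (k + 0))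

  toℕ+k<2k : (u : Fin k) → toℕ u + k < 2 * k
  toℕ+k<2k u = subst (toℕ u + k <_) (cong (k +_) (sym (+-identityʳ k))) (+-monoˡ-< k (Fin.toℕ<n u))

  residues-fromℕ< : ∀ {m} (m<2k : m < 2 * k) → residues (fromℕ< m<2k) ≡ (m mod k , m mod 2)
  residues-fromℕ< m<2k = cong (λ m → m mod k , m mod 2) (Fin.toℕ-fromℕ< m<2k)

  residues-surjective : ∀ p → ∃ λ X → residues X ≡ p
  residues-surjective (u , x) with toℕ u mod 2 Fin.≟ x
  ... | yes u≡x = fromℕ< (toℕ<2k u) ,
    trans (residues-fromℕ< (toℕ<2k u)) (cong₂ _,_ (toℕ-mod-self u) u≡x)
  ... | no u≢x = fromℕ< (toℕ+k<2k u) ,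
    trans (residues-fromℕ< (toℕ+k<2k u)) (cong₂ _,_ u+k≡u u+k≡x)
    where
    u+k≡u : (toℕ u + k) mod k ≡ u
    u+k≡u = trans (Equivalence.from (mod≡mod⇔ (toℕ u + k) (toℕ u) k) ([m+n]%n≡m%n (toℕ u) k))
                  (toℕ-mod-self u)
    u+k≢u : (toℕ u + k) mod 2 ≢ toℕ u mod 2
    u+k≢u = 2∤k ∘ Equivalence.to ([m+n]%d≡m%d⇔d∣n (toℕ u) k 2)
                ∘ Equivalence.to (mod≡mod⇔ (toℕ u + k) (toℕ u) 2)
    u+k≡x : (toℕ u + k) mod 2 ≡ x
    u+k≡x = ≢∧≢⇒≡ u+k≢u (u≢x ∘ sym)

  crt : Fin k × Fin 2 → Fin (2 * k)
  crt p = proj₁ (residues-surjective p)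

  residues-crt : ∀ p → residues (crt p) ≡ p
  residues-crt p = proj₂ (residues-surjective p)

  residues↔ : (Fin k × Fin 2) ↔ Fin (2 * k)
  residues↔ = mk↔ₛ′ crt residues (λ X → residues-injective (residues-crt (residues X))) residues-crt

  crown-adj⇔oddSet : ∀ {X Y a} → a ≡ X - Y modulo (2 * k) →
    Adj (Crown k) (residues X) (residues Y) ⇔ OddSet k ℓ a
  crown-adj⇔oddSet {X} {Y} {a} a≡X-Y = begin
    ((toℕ X mod 2 ≢ toℕ Y mod 2) × (toℕ X mod k ≢ toℕ Y mod k))
      ∼⟨ ¬-cong-⇔ (mod-difference (m∣m*n k) a≡X-Y)
         ×-⇔ ¬-cong-⇔ (mod-difference (n∣m*n 2) a≡X-Y) ⟩
    (2 ∤ toℕ a × k ∤ toℕ a)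
      ∼⟨ ⇔-sym (oddSet⇔ a) ⟩
    OddSet k ℓ a
      ∎
    where open Related.EquationalReasoning {k = Related.equivalence}

  residues-adjacency : ∀ X Y →
    Adj (Crown k) (residues X) (residues Y) ⇔ Adj (Circulant (2 * k) (OddSet k ℓ)) X Y
  residues-adjacency X Y = mk⇔
    (λ adj → let (a , a≡X-Y) = difference X Y
             in a , Equivalence.to (crown-adj⇔oddSet a≡X-Y) adj , a≡X-Y)
    (λ (a , a∈A , a≡X-Y) → Equivalence.from (crown-adj⇔oddSet a≡X-Y) a∈A)

  crown≅circulant : Crown k ≅ Circulant (2 * k) (OddSet k ℓ)
  crown≅circulant = record
    { bij     = residues↔
    ; adj-iff = λ p q →
        subst₂ (λ p′ q′ → Adj (Crown k) p′ q′ ⇔ Adj C (crt p) (crt q))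
               (residues-crt p) (residues-crt q) (residues-adjacency (crt p) (crt q))
    }
    where C = Circulant (2 * k) (OddSet k ℓ)

odd-crown≅circulant : ∀ {k} ℓ → k ≡ 2 * ℓ + 1 → Crown k ≅ Circulant (2 * k) (OddSet k ℓ)
odd-crown≅circulant ℓ k≡2ℓ+1 = subst (λ k → Crown k ≅ Circulant (2 * k) (OddSet k ℓ))
  (sym (trans k≡2ℓ+1 (+-comm (2 * ℓ) 1))) (OddCrown.crown≅circulant ℓ)

module CirculantCrown {k N : ℕ} {A : Fin (suc N) → Set}
                      (k≥3 : 3 ≤ k) (φ : Crown k ≅ Circulant (suc N) A) where
  private
    n = suc N
    C = Circulant n A
  open _≅_ φ
  open Inverse bij

  side : Fin n → Fin 2
  side x = proj₂ (from x)

  partner : Fin n → Fin n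
  partner x = to (mate (from x))

  side-partner : ∀ x → side (partner x) ≡ opposite (side x)
  side-partner x = cong proj₂ (strictlyInverseʳ (mate (from x)))

  partner-involutive : ∀ x → partner (partner x) ≡ x
  partner-involutive x = begin
    to (mate (from (to (mate (from x))))) ≡⟨ cong (to ∘ mate) (strictlyInverseʳ _) ⟩
    to (mate (mate (from x)))             ≡⟨ cong to (mate-involutive (from x)) ⟩
    to (from x)                           ≡⟨ strictlyInverseˡ x ⟩
    x                                     ∎
    where open ≡-Reasoning

  sameSide⇔CommonNeighbour : ∀ {x y} → side x ≡ side y ⇔ CommonNeighbour C x y
  sameSide⇔CommonNeighbour {x} {y} =
    ⇔-sym (crown-CommonNeighbour⇔ k≥3 (from x) (from y) ⇔-∘ ≅-from-CommonNeighbour⇔ φ)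

  partner⇔ : ∀ {x y} → (¬ Adj C x y × side x ≢ side y) ⇔ y ≡ partner x
  partner⇔ {x} {y} = begin
    (¬ Adj C x y × side x ≢ side y)
      ∼⟨ ¬-cong-⇔ (≅-from-Adj⇔ φ) ×-⇔ ⇔-id _ ⟩
    (¬ Adj (Crown k) (from x) (from y) × side x ≢ side y)
      ∼⟨ crown-mate⇔ (from x) (from y) ⟩
    from y ≡ mate (from x)
      ∼⟨ mk⇔ (λ e → sym (inverseˡ (sym e))) inverseʳ ⟩
    y ≡ partner x
      ∎
    where open Related.EquationalReasoning {k = Related.equivalence}

  rotate-side⇔ : ∀ {j x y} → j ≤ n → side (rotate j x) ≡ side (rotate j y) ⇔ side x ≡ side y
  rotate-side⇔ {j} {x} {y} j≤n = begin
    side (rotate j x) ≡ side (rotate j y)       ∼⟨ sameSide⇔CommonNeighbour ⟩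
    CommonNeighbour C (rotate j x) (rotate j y) ∼⟨ rotate-CommonNeighbour⇔ j≤n ⟩
    CommonNeighbour C x y                       ∼⟨ ⇔-sym sameSide⇔CommonNeighbour ⟩
    side x ≡ side y                             ∎
    where open Related.EquationalReasoning {k = Related.equivalence}

  rotate-partner : ∀ {j} → j ≤ n → ∀ x → partner (rotate j x) ≡ rotate j (partner x)
  rotate-partner j≤n x = sym (Equivalence.to partner⇔
    (¬adj ∘ Equivalence.to (rotate-Adj⇔ j≤n) , side≢ ∘ Equivalence.to (rotate-side⇔ j≤n)))
    where
    matched = Equivalence.from partner⇔ (refl {x = partner x})
    ¬adj = proj₁ matched
    side≢ = proj₂ matched

  side-rotate-2 : ∀ x → side (rotate 2 x) ≡ side x
  side-rotate-2 x = alternating⇒≡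
    (subst (λ z → side (rotate 1 x) ≡ side z ⇔ side x ≡ side (rotate 1 x))
           (rotate-rotate 1 1 x) (rotate-side⇔ (s≤s z≤n)))

  side-rotate-even : ∀ i x → side (rotate (2 * i) x) ≡ side x
  side-rotate-even zero x = cong side (rotate-zero x)
  side-rotate-even (suc i) x = begin
    side (rotate (2 * suc i) x)        ≡⟨ cong (λ j → side (rotate j x)) (*-suc 2 i) ⟩
    side (rotate (2 + 2 * i) x)        ≡⟨ cong side (rotate-rotate 2 (2 * i) x) ⟨
    side (rotate 2 (rotate (2 * i) x)) ≡⟨ side-rotate-2 _ ⟩
    side (rotate (2 * i) x)            ≡⟨ side-rotate-even i x ⟩
    side x                             ∎
    where open ≡-Reasoning

  toℕ-rotate-0F : ∀ {j} → j < n → toℕ (rotate j 0F) ≡ j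
  toℕ-rotate-0F {j} j<n =
    trans (toℕ-mod (j + 0) n) (trans (cong (_% n) (+-identityʳ j)) (m<n⇒m%n≡m j<n))

  d : ℕ
  d = toℕ (partner 0F)

  partner-0F : partner 0F ≡ rotate d 0F
  partner-0F = Fin.toℕ-injective (sym (toℕ-rotate-0F (Fin.toℕ<n (partner 0F))))

  d≢0 : d ≢ 0
  d≢0 d≡0 = opposite≢ (side 0F) (trans (sym (side-partner 0F)) (cong side partner≡0F))
    where
    partner≡0F : partner 0F ≡ 0F
    partner≡0F = Fin.toℕ-injective d≡0

  antipodal : 2 * d ≡ n
  antipodal = begin
    d + (d + 0) ≡⟨ cong (d +_) (trans (+-identityʳ d) (sym n∸d≡d)) ⟩
    d + (n ∸ d) ≡⟨ m+[n∸m]≡n d≤n ⟩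
    n           ∎
    where
    open ≡-Reasoning
    d≤n = <⇒≤ (Fin.toℕ<n (partner 0F))
    rotate-n∸d≡partner : rotate (n ∸ d) 0F ≡ partner 0F
    rotate-n∸d≡partner = begin
      rotate (n ∸ d) 0F                      ≡⟨ partner-involutive _ ⟨
      partner (partner (rotate (n ∸ d) 0F))  ≡⟨ cong partner (rotate-partner (m∸n≤m n d) 0F) ⟩
      partner (rotate (n ∸ d) (partner 0F))  ≡⟨ cong (partner ∘ rotate (n ∸ d)) partner-0F ⟩
      partner (rotate (n ∸ d) (rotate d 0F)) ≡⟨ cong partner (rotate-retraction d≤n 0F) ⟩
      partner 0F                             ∎
    n∸d≡d : n ∸ d ≡ d
    n∸d≡d = trans (sym (toℕ-rotate-0F (∸-monoʳ-< (n≢0⇒n>0 d≢0) d≤n)))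
                  (cong toℕ rotate-n∸d≡partner)

  k-odd : 2 ∤ k
  k-odd (divides m k≡m*2) = opposite≢ (side 0F) (begin
    opposite (side 0F)       ≡⟨ side-partner 0F ⟨
    side (partner 0F)        ≡⟨ cong side partner-0F ⟩
    side (rotate d 0F)       ≡⟨ cong (λ j → side (rotate j 0F)) d≡2m ⟩
    side (rotate (2 * m) 0F) ≡⟨ side-rotate-even m 0F ⟩
    side 0F                  ∎)
    where
    open ≡-Reasoning
    n≡2k : n ≡ 2 * k
    n≡2k = trans (sym (↔⇒≡ (↔-trans Fin.*↔× bij))) (*-comm k 2)
    d≡2m : d ≡ 2 * m
    d≡2m = trans (*-cancelˡ-≡ d k 2 (trans antipodal n≡2k)) (trans k≡m*2 (*-comm m 2))

crown≅circulant⇒odd : ∀ {k n A} → 3 ≤ k → Crown k ≅ Circulant n A → 2 ∤ k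
crown≅circulant⇒odd {n = zero} (s≤s _) φ = ⊥-elim (Fin.¬Fin0 (Inverse.to (_≅_.bij φ) (0F , 0F)))
crown≅circulant⇒odd {n = suc _} k≥3 φ = CirculantCrown.k-odd k≥3 φ

proposition33 : (k : ℕ) → 3 ≤ k →
    ((ℓ : ℕ) → k ≡ 2 * ℓ + 1 → Crown k ≅ Circulant (2 * k) (OddSet k ℓ))
    × (2 ∣ k → (n : ℕ) (A : Fin n → Set) → ZeroFree A → SymmetricSet A → ¬ (Crown k ≅ Circulant n A))
proposition33 k k≥3 =
  odd-crown≅circulant ,
  λ 2∣k n A _ _ φ → crown≅circulant⇒odd k≥3 φ 2∣k
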